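{- For every even positive integer $k$: if $k\equiv 0\pmod 4$ then $\alpha(K_3^{k_{(3)}})=3^{k/2}$; and if $k\equiv 2\pmod 4$ then $\frac{1}{3}3^{k/2}\leq \alpha(K_3^{k_{(3)}})<\frac12 3^{k/2}$.
   Context: $K_3$ is the complete graph on 3 vertices. For a graph $G$ and integers $k,p\geq1$, $G^{k_{(p)}}$ is the graph with vertex set $V(G)^k$ in which $(u_1,\dots,u_k)$ and $(v_1,\dots,v_k)$ are adjacent iff $|\{i: u_iv_i\in E(G)\}|\not\equiv 0\pmod p$. $\alpha$ denotes the independence number. -}

module Defs where

open import Data.Nat using (ℕ; zero; suc; _≤_; NonZero)
open import Data.Nat.DivMod using (_%_)
open import Data.Fin using (Fin)
open import Data.Fin.Properties using () renaming (_≟_ to _≟ᶠ_)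
open import Data.Vec using (Vec; []; _∷_)
open import Data.List using (List; length)
open import Data.List.Relation.Unary.AllPairs using (AllPairs)
open import Data.Product using (Σ; _×_)
open import Relation.Binary.PropositionalEquality using (_≡_; _≢_)
open import Relation.Nullary using (¬_; Dec; yes; no)

record Graph : Set₁ where
  field
    V    : Set
    Adj  : V → V → Set
    adj? : (u v : V) → Dec (Adj u v)

open Graph public

K₃ : Graph
K₃ = record { V = Fin 3 ; Adj = λ u v → u ≢ v ; adj? = dec }
  where
  dec : (u v : Fin 3) → Dec (u ≢ v)
  dec u v with u ≟ᶠ v
  ... | yes e = no (λ ne → ne e)
  ... | no ne = yes ne

adjCount : (G : Graph) {k : ℕ} → Vec (V G) k → Vec (V G) k → ℕ
adjCount G [] [] = 0
adjCount G (u ∷ us) (v ∷ vs) with adj? G u v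
... | yes _ = suc (adjCount G us vs)
... | no  _ = adjCount G us vs

powGraph : (G : Graph) (k p : ℕ) .{{_ : NonZero p}} → Graph
powGraph G k p = record
  { V = Vec (V G) k
  ; Adj = λ u v → adjCount G u v % p ≢ 0
  ; adj? = λ u v → dec (adjCount G u v % p)
  }
  where
  dec : (n : ℕ) → Dec (n ≢ 0)
  dec zero = no (λ ne → ne _≡_.refl)
  dec (suc n) = yes (λ ())

IsIndependent : (G : Graph) → List (V G) → Set
IsIndependent G S = AllPairs (λ u v → u ≢ v) S × AllPairs (λ u v → ¬ Adj G u v × ¬ Adj G v u) S

IsIndependenceNumber : (G : Graph) → ℕ → Set
IsIndependenceNumber G m =
  Σ (List (V G)) (λ S → IsIndependent G S × length S ≡ m)
  × ((S : List (V G)) → IsIndependent G S → length S ≤ m)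

-- Vertices are vectors of 𝔽₃ᵏ, and two of them are non-adjacent exactly when their difference d
-- is isotropic, Σ dᵢ² = 0, because every nonzero element of 𝔽₃ squares to 1. Translating an
-- independent set so that it contains 0 and polarising (2 is invertible in 𝔽₃) turns it into a
-- totally isotropic set. A sum of four squares over 𝔽₃ is two hyperbolic planes, so for
-- k = 4m + a with a ∈ {0, 2} the form is 2m hyperbolic planes orthogonal to the anisotropic
-- form x² + y² (or nothing); a totally isotropic set there has at most 3^(2m) elements, since
-- splitting off one hyperbolic plane partitions the set into three pieces that embed into the
-- remaining space. Conversely the m-th power of the tetracode, padded with zeros, is an
-- independent set of size 9^m.
module Submission where

open import Defs
open import Data.Nat using (ℕ; zero; suc; _+_; _*_; _^_; _≤_; _<_; _≥_; z≤n; s≤s)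
  renaming (_≟_ to _≟ℕ_)
open import Data.Nat.DivMod using (_%_; _/_; m≡m%n+[m/n]*n; m*n/n≡m)
open import Data.Nat.Properties
  using (+-comm; +-assoc; +-suc; +-identityʳ; +-mono-≤; *-assoc; *-distribʳ-+; m^n>0; +-monoˡ-<; ≤-reflexive; ≤-trans)
open import Data.Fin using (Fin; zero; suc)
open import Data.Fin.Properties using (_≟_; all?)
open import Data.Vec using (Vec; []; _∷_; head; tail; zipWith; replicate; _++_)
import Data.Vec as Vec
open import Data.Vec.Properties using (++-injective; ≡-dec)
open import Data.List using (List; []; _∷_; length; map; filter; cartesianProductWith)
open import Data.List.Properties using (length-map; length-++)
open import Data.List.Membership.Propositional using (_∈_; find)
open import Data.List.Membership.Propositional.Properties using (∈-map⁻; ∈-filter⁻; ∈-cartesianProductWith⁻)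
open import Data.List.Relation.Unary.Any using (here; there)
open import Data.List.Relation.Unary.All as All using (All; []; _∷_)
open import Data.List.Relation.Unary.All.Properties using (¬All⇒Any¬)
open import Data.List.Relation.Unary.AllPairs using (AllPairs; []; _∷_; allPairs?)
import Data.List.Relation.Unary.AllPairs.Properties as AllPairs
open import Data.List.Relation.Unary.Unique.Propositional using (Unique)
import Data.List.Relation.Unary.Unique.Propositional.Properties as Unique
open import Data.Product using (Σ; _×_; _,_; proj₁; proj₂)
open import Data.Sum using (_⊎_; inj₁; inj₂)
open import Function.Bundles using (_⇔_; mk⇔; Equivalence)
open import Relation.Nullary using (¬_; Dec; contradiction)
open import Function using (_∘′_)
open import Relation.Nullary.Decidable using (from-yes; decidable-stable; ¬?; _→-dec_; yes; no)
open import Relation.Binary.PropositionalEquality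
open ≡-Reasoning

private variable
  a k m n : ℕ

𝔽₃ : Set
𝔽₃ = Fin 3

pattern 𝟎 = zero
pattern 𝟏 = suc zero
pattern 𝟐 = suc (suc zero)

infixl 6 _⊕_ _⊖_
infixl 7 _⊗_

_⊕_ : 𝔽₃ → 𝔽₃ → 𝔽₃
𝟎 ⊕ y = y
𝟏 ⊕ 𝟎 = 𝟏
𝟏 ⊕ 𝟏 = 𝟐
𝟏 ⊕ 𝟐 = 𝟎
𝟐 ⊕ 𝟎 = 𝟐
𝟐 ⊕ 𝟏 = 𝟎
𝟐 ⊕ 𝟐 = 𝟏

_⊖_ : 𝔽₃ → 𝔽₃ → 𝔽₃
x ⊖ 𝟎 = x
𝟎 ⊖ 𝟏 = 𝟐
𝟏 ⊖ 𝟏 = 𝟎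
𝟐 ⊖ 𝟏 = 𝟏
𝟎 ⊖ 𝟐 = 𝟏
𝟏 ⊖ 𝟐 = 𝟐
𝟐 ⊖ 𝟐 = 𝟎

_⊗_ : 𝔽₃ → 𝔽₃ → 𝔽₃
𝟎 ⊗ y = 𝟎
𝟏 ⊗ y = y
𝟐 ⊗ 𝟎 = 𝟎
𝟐 ⊗ 𝟏 = 𝟐
𝟐 ⊗ 𝟐 = 𝟏

⊕-assoc : ∀ x y z → x ⊕ y ⊕ z ≡ x ⊕ (y ⊕ z)
⊕-assoc = from-yes (all? λ x → all? λ y → all? λ z → x ⊕ y ⊕ z ≟ x ⊕ (y ⊕ z))

⊕-exchange : ∀ x y z → x ⊕ (y ⊕ z) ≡ y ⊕ (x ⊕ z)
⊕-exchange = from-yes (all? λ x → all? λ y → all? λ z → x ⊕ (y ⊕ z) ≟ y ⊕ (x ⊕ z))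

⊕-cancelˡ : ∀ x y z → x ⊕ y ≡ x ⊕ z → y ≡ z
⊕-cancelˡ = from-yes (all? λ x → all? λ y → all? λ z → (x ⊕ y ≟ x ⊕ z) →-dec (y ≟ z))

⊕-cancelʳ : ∀ x y z → y ⊕ x ≡ z ⊕ x → y ≡ z
⊕-cancelʳ = from-yes (all? λ x → all? λ y → all? λ z → (y ⊕ x ≟ z ⊕ x) →-dec (y ≟ z))

⊖-cancelʳ : ∀ x y z → y ⊖ x ≡ z ⊖ x → y ≡ z
⊖-cancelʳ = from-yes (all? λ x → all? λ y → all? λ z → (y ⊖ x ≟ z ⊖ x) →-dec (y ≟ z))

⊖-⊖-cancelʳ : ∀ x y z → (x ⊖ z) ⊖ (y ⊖ z) ≡ x ⊖ y
⊖-⊖-cancelʳ = from-yes (all? λ x → all? λ y → all? λ z → (x ⊖ z) ⊖ (y ⊖ z) ≟ x ⊖ y)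

⊕-⊖-interchange : ∀ w x y z → (w ⊕ y) ⊖ (x ⊕ z) ≡ (w ⊖ x) ⊕ (y ⊖ z)
⊕-⊖-interchange = from-yes (all? λ w → all? λ x → all? λ y → all? λ z →
  (w ⊕ y) ⊖ (x ⊕ z) ≟ (w ⊖ x) ⊕ (y ⊖ z))

⊗-comm : ∀ x y → x ⊗ y ≡ y ⊗ x
⊗-comm = from-yes (all? λ x → all? λ y → x ⊗ y ≟ y ⊗ x)

⊗-assoc : ∀ x y z → x ⊗ y ⊗ z ≡ x ⊗ (y ⊗ z)
⊗-assoc = from-yes (all? λ x → all? λ y → all? λ z → x ⊗ y ⊗ z ≟ x ⊗ (y ⊗ z))

⊗-zeroʳ : ∀ x → x ⊗ 𝟎 ≡ 𝟎
⊗-zeroʳ = from-yes (all? λ x → x ⊗ 𝟎 ≟ 𝟎)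

⊗-distribˡ-⊕ : ∀ x y z → x ⊗ (y ⊕ z) ≡ x ⊗ y ⊕ x ⊗ z
⊗-distribˡ-⊕ = from-yes (all? λ x → all? λ y → all? λ z → x ⊗ (y ⊕ z) ≟ x ⊗ y ⊕ x ⊗ z)

⊗-distribʳ-⊖ : ∀ x y z → (x ⊖ y) ⊗ z ≡ x ⊗ z ⊖ y ⊗ z
⊗-distribʳ-⊖ = from-yes (all? λ x → all? λ y → all? λ z → (x ⊖ y) ⊗ z ≟ x ⊗ z ⊖ y ⊗ z)

⊗-cancelʳ : ∀ x y z → x ≢ 𝟎 → y ⊗ x ≡ z ⊗ x → y ≡ z
⊗-cancelʳ = from-yes (all? λ x → all? λ y → all? λ z → ¬? (x ≟ 𝟎) →-dec (y ⊗ x ≟ z ⊗ x) →-dec (y ≟ z))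

y⊖y⊗x⊗x≡𝟎 : ∀ x y → x ≢ 𝟎 → y ⊖ y ⊗ x ⊗ x ≡ 𝟎
y⊖y⊗x⊗x≡𝟎 = from-yes (all? λ x → all? λ y → ¬? (x ≟ 𝟎) →-dec (y ⊖ y ⊗ x ⊗ x ≟ 𝟎))

⊖-self : ∀ x → x ⊖ x ≡ 𝟎
⊖-self = from-yes (all? λ x → x ⊖ x ≟ 𝟎)

distinct-difference-square : ∀ x y → x ≢ y → (x ⊖ y) ⊗ (x ⊖ y) ≡ 𝟏
distinct-difference-square = from-yes (all? λ x → all? λ y → ¬? (x ≟ y) →-dec ((x ⊖ y) ⊗ (x ⊖ y) ≟ 𝟏))

𝟎⊖x⊖x≡𝟎⇒x≡𝟎 : ∀ x → 𝟎 ⊖ x ⊖ x ≡ 𝟎 → x ≡ 𝟎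
𝟎⊖x⊖x≡𝟎⇒x≡𝟎 = from-yes (all? λ x → (𝟎 ⊖ x ⊖ x ≟ 𝟎) →-dec (x ≟ 𝟎))

⟦_⟧ : ℕ → 𝔽₃
⟦ zero ⟧ = 𝟎
⟦ suc n ⟧ = 𝟏 ⊕ ⟦ n ⟧

⟦3+n⟧≡⟦n⟧ : ∀ n → ⟦ 3 + n ⟧ ≡ ⟦ n ⟧
⟦3+n⟧≡⟦n⟧ n = from-yes (all? λ x → 𝟏 ⊕ (𝟏 ⊕ (𝟏 ⊕ x)) ≟ x) ⟦ n ⟧

⟦⟧≡𝟎⇒%3≡0 : ∀ n → ⟦ n ⟧ ≡ 𝟎 → n % 3 ≡ 0
⟦⟧≡𝟎⇒%3≡0 0 _ = refl
⟦⟧≡𝟎⇒%3≡0 (suc (suc (suc n))) ⟦n+3⟧≡𝟎 = ⟦⟧≡𝟎⇒%3≡0 n (trans (sym (⟦3+n⟧≡⟦n⟧ n)) ⟦n+3⟧≡𝟎)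

%3≡0⇒⟦⟧≡𝟎 : ∀ n → n % 3 ≡ 0 → ⟦ n ⟧ ≡ 𝟎
%3≡0⇒⟦⟧≡𝟎 0 _ = refl
%3≡0⇒⟦⟧≡𝟎 (suc (suc (suc n))) n%3≡0 = trans (⟦3+n⟧≡⟦n⟧ n) (%3≡0⇒⟦⟧≡𝟎 n n%3≡0)

infixl 6 _-ᵥ_
infixr 7 _•_
infix 8 _·_

_-ᵥ_ : Vec 𝔽₃ n → Vec 𝔽₃ n → Vec 𝔽₃ n
_-ᵥ_ = zipWith _⊖_

_•_ : 𝔽₃ → Vec 𝔽₃ n → Vec 𝔽₃ n
s • u = Vec.map (s ⊗_) u

_·_ : Vec 𝔽₃ n → Vec 𝔽₃ n → 𝔽₃
[] · [] = 𝟎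
(x ∷ u) · (y ∷ v) = x ⊗ y ⊕ u · v

-ᵥ-cancelʳ : (u v w : Vec 𝔽₃ n) → u -ᵥ w ≡ v -ᵥ w → u ≡ v
-ᵥ-cancelʳ [] [] [] _ = refl
-ᵥ-cancelʳ (x ∷ u) (y ∷ v) (z ∷ w) eq =
  cong₂ _∷_ (⊖-cancelʳ z x y (cong head eq)) (-ᵥ-cancelʳ u v w (cong tail eq))

-ᵥ--ᵥ-cancelʳ : (u v w : Vec 𝔽₃ n) → (u -ᵥ w) -ᵥ (v -ᵥ w) ≡ u -ᵥ v
-ᵥ--ᵥ-cancelʳ [] [] [] = refl
-ᵥ--ᵥ-cancelʳ (x ∷ u) (y ∷ v) (z ∷ w) = cong₂ _∷_ (⊖-⊖-cancelʳ x y z) (-ᵥ--ᵥ-cancelʳ u v w)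

·-self-difference : (u : Vec 𝔽₃ n) → (u -ᵥ u) · (u -ᵥ u) ≡ 𝟎
·-self-difference [] = refl
·-self-difference (x ∷ u) rewrite ⊖-self x = ·-self-difference u

·-++ : (u v : Vec 𝔽₃ m) (u′ v′ : Vec 𝔽₃ n) → (u ++ u′) · (v ++ v′) ≡ u · v ⊕ u′ · v′
·-++ [] [] u′ v′ = refl
·-++ (x ∷ u) (y ∷ v) u′ v′ = trans (cong (x ⊗ y ⊕_) (·-++ u v u′ v′)) (sym (⊕-assoc (x ⊗ y) (u · v) (u′ · v′)))

-ᵥ-++ : (u v : Vec 𝔽₃ m) (u′ v′ : Vec 𝔽₃ n) → (u ++ u′) -ᵥ (v ++ v′) ≡ (u -ᵥ v) ++ (u′ -ᵥ v′)
-ᵥ-++ [] [] u′ v′ = refl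
-ᵥ-++ (x ∷ u) (y ∷ v) u′ v′ = cong (x ⊖ y ∷_) (-ᵥ-++ u v u′ v′)

record IsSymmetricBilinear (B : Vec 𝔽₃ n → Vec 𝔽₃ n → 𝔽₃) : Set where
  field
    symmetric : ∀ u v → B u v ≡ B v u
    -ᵥ-homoˡ  : ∀ u v w → B (u -ᵥ v) w ≡ B u w ⊖ B v w
    •-homoˡ   : ∀ s u w → B (s • u) w ≡ s ⊗ B u w

  shift-orthogonal : ∀ s {u w z} → B u z ≡ 𝟎 → B w z ≡ 𝟎 → B (u -ᵥ s • w) z ≡ 𝟎
  shift-orthogonal s {u} {w} {z} Buz≡𝟎 Bwz≡𝟎 = begin
    B (u -ᵥ s • w) z    ≡⟨ -ᵥ-homoˡ u (s • w) z ⟩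
    B u z ⊖ B (s • w) z ≡⟨ cong (B u z ⊖_) (•-homoˡ s w z) ⟩
    B u z ⊖ s ⊗ B w z   ≡⟨ cong₂ (λ b c → b ⊖ s ⊗ c) Buz≡𝟎 Bwz≡𝟎 ⟩
    𝟎 ⊖ s ⊗ 𝟎           ≡⟨ cong (𝟎 ⊖_) (⊗-zeroʳ s) ⟩
    𝟎                   ∎

  shifts-orthogonal : ∀ s {u v w} → B u v ≡ 𝟎 → B u w ≡ 𝟎 → B w v ≡ 𝟎 → B w w ≡ 𝟎 →
                      B (u -ᵥ s • w) (v -ᵥ s • w) ≡ 𝟎
  shifts-orthogonal s {u} {v} {w} Buv≡𝟎 Buw≡𝟎 Bwv≡𝟎 Bww≡𝟎 = shift-orthogonal s
    (trans (symmetric u _) (shift-orthogonal s (trans (symmetric v u) Buv≡𝟎) (trans (symmetric w u) Buw≡𝟎)))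
    (trans (symmetric w _) (shift-orthogonal s (trans (symmetric v w) Bwv≡𝟎) Bww≡𝟎))

  -ᵥ-homoʳ : ∀ w u v → B w (u -ᵥ v) ≡ B w u ⊖ B w v
  -ᵥ-homoʳ w u v = begin
    B w (u -ᵥ v)     ≡⟨ symmetric w (u -ᵥ v) ⟩
    B (u -ᵥ v) w     ≡⟨ -ᵥ-homoˡ u v w ⟩
    B u w ⊖ B v w    ≡⟨ cong₂ _⊖_ (symmetric u w) (symmetric v w) ⟩
    B w u ⊖ B w v    ∎

  isotropic-difference⇒orthogonal : ∀ {u v} → B u u ≡ 𝟎 → B v v ≡ 𝟎 → B (u -ᵥ v) (u -ᵥ v) ≡ 𝟎 → B u v ≡ 𝟎
  isotropic-difference⇒orthogonal {u} {v} Buu≡𝟎 Bvv≡𝟎 Bdd≡𝟎 = 𝟎⊖x⊖x≡𝟎⇒x≡𝟎 (B u v) (begin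
    (𝟎 ⊖ B u v) ⊖ (B u v ⊖ 𝟎)             ≡⟨ cong₂ (λ b c → (b ⊖ B u v) ⊖ (B u v ⊖ c)) (sym Buu≡𝟎) (sym Bvv≡𝟎) ⟩
    (B u u ⊖ B u v) ⊖ (B u v ⊖ B v v)     ≡⟨ cong (λ c → (B u u ⊖ B u v) ⊖ (c ⊖ B v v)) (symmetric u v) ⟩
    (B u u ⊖ B u v) ⊖ (B v u ⊖ B v v)     ≡⟨ cong₂ _⊖_ (-ᵥ-homoʳ u u v) (-ᵥ-homoʳ v u v) ⟨
    B u (u -ᵥ v) ⊖ B v (u -ᵥ v)           ≡⟨ -ᵥ-homoˡ u v (u -ᵥ v) ⟨
    B (u -ᵥ v) (u -ᵥ v)                   ≡⟨ Bdd≡𝟎 ⟩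
    𝟎                                     ∎)

·-isSymmetricBilinear : IsSymmetricBilinear (_·_ {n})
·-isSymmetricBilinear = record { symmetric = symmetric ; -ᵥ-homoˡ = -ᵥ-homoˡ ; •-homoˡ = •-homoˡ }
  where
  symmetric : (u v : Vec 𝔽₃ n) → u · v ≡ v · u
  symmetric [] [] = refl
  symmetric (x ∷ u) (y ∷ v) = cong₂ _⊕_ (⊗-comm x y) (symmetric u v)

  -ᵥ-homoˡ : (u v w : Vec 𝔽₃ n) → (u -ᵥ v) · w ≡ u · w ⊖ v · w
  -ᵥ-homoˡ [] [] [] = refl
  -ᵥ-homoˡ (x ∷ u) (y ∷ v) (z ∷ w) = begin
    (x ⊖ y) ⊗ z ⊕ (u -ᵥ v) · w         ≡⟨ cong₂ _⊕_ (⊗-distribʳ-⊖ x y z) (-ᵥ-homoˡ u v w) ⟩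
    (x ⊗ z ⊖ y ⊗ z) ⊕ (u · w ⊖ v · w)  ≡⟨ ⊕-⊖-interchange (x ⊗ z) (y ⊗ z) (u · w) (v · w) ⟨
    (x ⊗ z ⊕ u · w) ⊖ (y ⊗ z ⊕ v · w)  ∎

  •-homoˡ : ∀ s (u w : Vec 𝔽₃ n) → (s • u) · w ≡ s ⊗ u · w
  •-homoˡ s [] [] = sym (⊗-zeroʳ s)
  •-homoˡ s (x ∷ u) (z ∷ w) = begin
    s ⊗ x ⊗ z ⊕ (s • u) · w      ≡⟨ cong₂ _⊕_ (⊗-assoc s x z) (•-homoˡ s u w) ⟩
    s ⊗ (x ⊗ z) ⊕ s ⊗ u · w      ≡⟨ ⊗-distribˡ-⊕ s (x ⊗ z) (u · w) ⟨
    s ⊗ (x ⊗ z ⊕ u · w)          ∎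

-- On coordinates (x₁, y₁, …, xₙ, yₙ, z) with z ∈ 𝔽₃ᵃ, hyperbolic n is Σᵢ (xᵢ yᵢ′ + yᵢ xᵢ′) + z · z′.
swapPlanes : ∀ n → Vec 𝔽₃ (n * 2 + a) → Vec 𝔽₃ (n * 2 + a)
swapPlanes zero v = v
swapPlanes (suc n) (x ∷ y ∷ v) = y ∷ x ∷ swapPlanes n v

hyperbolic : ∀ n → Vec 𝔽₃ (n * 2 + a) → Vec 𝔽₃ (n * 2 + a) → 𝔽₃
hyperbolic n u v = u · swapPlanes n v

·-swapPlanes : ∀ n (u v : Vec 𝔽₃ (n * 2 + a)) → u · swapPlanes n v ≡ swapPlanes n u · v
·-swapPlanes zero u v = refl
·-swapPlanes (suc n) (x ∷ y ∷ u) (x′ ∷ y′ ∷ v) = begin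
  x ⊗ y′ ⊕ (y ⊗ x′ ⊕ u · swapPlanes n v)   ≡⟨ ⊕-exchange (x ⊗ y′) (y ⊗ x′) _ ⟩
  y ⊗ x′ ⊕ (x ⊗ y′ ⊕ u · swapPlanes n v)   ≡⟨ cong (λ c → y ⊗ x′ ⊕ (x ⊗ y′ ⊕ c)) (·-swapPlanes n u v) ⟩
  y ⊗ x′ ⊕ (x ⊗ y′ ⊕ swapPlanes n u · v)   ∎

hyperbolic-isSymmetricBilinear : ∀ n → IsSymmetricBilinear (hyperbolic {a} n)
hyperbolic-isSymmetricBilinear n = record
  { symmetric = λ u v → trans (·-swapPlanes n u v) (symmetric (swapPlanes n u) v)
  ; -ᵥ-homoˡ  = λ u v w → -ᵥ-homoˡ u v (swapPlanes n w)
  ; •-homoˡ   = λ s u w → •-homoˡ s u (swapPlanes n w)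
  }
  where open IsSymmetricBilinear ·-isSymmetricBilinear

dropPlane : Vec 𝔽₃ (suc (suc n)) → Vec 𝔽₃ n
dropPlane u = tail (tail u)

second : Vec 𝔽₃ (suc (suc n)) → 𝔽₃
second u = head (tail u)

≡-byFirstPlane : (u v : Vec 𝔽₃ (suc (suc n))) →
                 head u ≡ head v → second u ≡ second v → dropPlane u ≡ dropPlane v → u ≡ v
≡-byFirstPlane (x ∷ y ∷ u) (.x ∷ .y ∷ .u) refl refl refl = refl

hyperbolic-dropPlane : ∀ n (u v : Vec 𝔽₃ (suc n * 2 + a)) → head u ≡ 𝟎 → head v ≡ 𝟎 →
                       hyperbolic n (dropPlane u) (dropPlane v) ≡ hyperbolic (suc n) u v
hyperbolic-dropPlane n (.𝟎 ∷ y ∷ u) (.𝟎 ∷ y′ ∷ v) refl refl = cong (_⊕ hyperbolic n u v) (sym (⊗-zeroʳ y))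

module _ {A : Set} where

  allPairs-lookup : ∀ {R : A → A → Set} {xs u v} → AllPairs R xs → u ∈ xs → v ∈ xs → u ≡ v ⊎ R u v ⊎ R v u
  allPairs-lookup (_ ∷ _) (here refl) (here refl) = inj₁ refl
  allPairs-lookup (Rx ∷ _) (here refl) (there v∈) = inj₂ (inj₁ (All.lookup Rx v∈))
  allPairs-lookup (Rx ∷ _) (there u∈) (here refl) = inj₂ (inj₂ (All.lookup Rx u∈))
  allPairs-lookup (_ ∷ Rxs) (there u∈) (there v∈) = allPairs-lookup Rxs u∈ v∈

  allPairs-tabulate : ∀ {R : A → A → Set} xs → (∀ {u v} → u ∈ xs → v ∈ xs → R u v) → AllPairs R xs
  allPairs-tabulate [] _ = []
  allPairs-tabulate (_ ∷ xs) R-∈ =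
    All.tabulate (R-∈ (here refl) ∘′ there) ∷ allPairs-tabulate xs (λ u∈ v∈ → R-∈ (there u∈) (there v∈))

  allPairs-map-∈ : ∀ {R S : A → A → Set} {xs} → (∀ {u v} → u ∈ xs → v ∈ xs → R u v → S u v) →
                   AllPairs R xs → AllPairs S xs
  allPairs-map-∈ R⇒S [] = []
  allPairs-map-∈ R⇒S (Rx ∷ Rxs) =
    All.tabulate (λ v∈ → R⇒S (here refl) (there v∈) (All.lookup Rx v∈)) ∷ allPairs-map-∈ (λ u∈ v∈ → R⇒S (there u∈) (there v∈)) Rxs

  unique-map⁺ : ∀ {B : Set} (f : A → B) {xs} → Unique xs →
                (∀ {u v} → u ∈ xs → v ∈ xs → f u ≡ f v → u ≡ v) → Unique (map f xs)
  unique-map⁺ f xs! f-inj = AllPairs.map⁺ (allPairs-map-∈ (λ u∈ v∈ u≢v fu≡fv → u≢v (f-inj u∈ v∈ fu≡fv)) xs!)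

  unique-length≤1 : ∀ (c : A) xs → Unique xs → (∀ {u} → u ∈ xs → u ≡ c) → length xs ≤ 1
  unique-length≤1 c [] _ _ = z≤n
  unique-length≤1 c (x ∷ []) _ _ = s≤s z≤n
  unique-length≤1 c (x ∷ y ∷ _) ((x≢y ∷ _) ∷ _) ≡c = contradiction (trans (≡c (here refl)) (sym (≡c (there (here refl))))) x≢y

  fibre : (A → 𝔽₃) → 𝔽₃ → List A → List A
  fibre key j = filter (λ u → key u ≟ j)

  ∈-fibre⁻ : ∀ key j {xs u} → u ∈ fibre key j xs → u ∈ xs × key u ≡ j
  ∈-fibre⁻ key j = ∈-filter⁻ (λ u → key u ≟ j)

  length-fibres : ∀ key xs → length xs ≡ length (fibre key 𝟎 xs) + length (fibre key 𝟏 xs) + length (fibre key 𝟐 xs)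
  length-fibres key [] = refl
  length-fibres key (x ∷ xs) with key x
  ... | 𝟎 = cong suc (length-fibres key xs)
  ... | 𝟏 = trans (cong suc (length-fibres key xs)) (cong (_+ length (fibre key 𝟐 xs)) (sym (+-suc _ _)))
  ... | 𝟐 = trans (cong suc (length-fibres key xs)) (sym (+-suc _ _))

  length≤3*-byFibres : ∀ key xs {b} → (∀ j → length (fibre key j xs) ≤ b) → length xs ≤ 3 * b
  length≤3*-byFibres key xs {b} fibre≤ rewrite length-fibres key xs =
    ≤-trans (+-mono-≤ (+-mono-≤ (fibre≤ 𝟎) (fibre≤ 𝟏)) (fibre≤ 𝟐)) (≤-reflexive b+b+b≡3*b)
    where
    b+b+b≡3*b : b + b + b ≡ 3 * b
    b+b+b≡3*b = trans (+-assoc b b b) (cong (λ c → b + (b + c)) (sym (+-identityʳ b)))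

TotallyIsotropic : (Vec 𝔽₃ n → Vec 𝔽₃ n → 𝔽₃) → List (Vec 𝔽₃ n) → Set
TotallyIsotropic B S = ∀ {u v} → u ∈ S → v ∈ S → B u v ≡ 𝟎

totallyIsotropic-map : ∀ {A : Set} {B : Vec 𝔽₃ n → Vec 𝔽₃ n → 𝔽₃} (f : A → Vec 𝔽₃ n) {xs} →
                       (∀ {u v} → u ∈ xs → v ∈ xs → B (f u) (f v) ≡ 𝟎) → TotallyIsotropic B (map f xs)
totallyIsotropic-map f B≡𝟎 u∈ v∈ with ∈-map⁻ f u∈ | ∈-map⁻ f v∈
... | _ , u′∈ , refl | _ , v′∈ , refl = B≡𝟎 u′∈ v′∈

Anisotropic : ℕ → Set
Anisotropic a = ∀ (v : Vec 𝔽₃ a) → v · v ≡ 𝟎 → v ≡ replicate a 𝟎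

module SplitPlane {a n : ℕ}
  (ih : ∀ (T : List (Vec 𝔽₃ (n * 2 + a))) → Unique T → TotallyIsotropic (hyperbolic n) T → length T ≤ 3 ^ n)
  {S : List (Vec 𝔽₃ (suc n * 2 + a))} (S! : Unique S) (S-iso : TotallyIsotropic (hyperbolic (suc n)) S)
  where

  fibre-length≤ : ∀ key j (f : Vec 𝔽₃ (suc n * 2 + a) → Vec 𝔽₃ (n * 2 + a)) →
                  (∀ {u v} → u ∈ fibre key j S → v ∈ fibre key j S → f u ≡ f v → u ≡ v) →
                  (∀ {u v} → u ∈ fibre key j S → v ∈ fibre key j S → hyperbolic n (f u) (f v) ≡ 𝟎) →
                  length (fibre key j S) ≤ 3 ^ n
  fibre-length≤ key j f f-inj f-iso =
    subst (_≤ 3 ^ n) (length-map f (fibre key j S)) (ih _ (unique-map⁺ f (Unique.filter⁺ _ S!) f-inj) (totallyIsotropic-map f f-iso))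

  length≤-headsVanish : (∀ {u} → u ∈ S → head u ≡ 𝟎) → length S ≤ 3 ^ suc n
  length≤-headsVanish head≡𝟎 = length≤3*-byFibres second S λ j → fibre-length≤ second j dropPlane
    (λ {u} {v} u∈ v∈ → let u∈S , yᵤ≡j = ∈-fibre⁻ second j u∈ ; v∈S , yᵥ≡j = ∈-fibre⁻ second j v∈ in
      ≡-byFirstPlane u v (trans (head≡𝟎 u∈S) (sym (head≡𝟎 v∈S))) (trans yᵤ≡j (sym yᵥ≡j)))
    (λ {u} {v} u∈ v∈ → let u∈S , _ = ∈-fibre⁻ second j u∈ ; v∈S , _ = ∈-fibre⁻ second j v∈ in
      trans (hyperbolic-dropPlane n u v (head≡𝟎 u∈S) (head≡𝟎 v∈S)) (S-iso u∈S v∈S))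

  length≤-headNonzero : ∀ {w} → w ∈ S → head w ≢ 𝟎 → length S ≤ 3 ^ suc n
  length≤-headNonzero {c ∷ d ∷ w′} w∈S c≢𝟎 =
    length≤3*-byFibres head S λ j → fibre-length≤ head j (dropPlane ∘′ clear j) (clear-injective j) (clear-isotropic j)
    where
    open IsSymmetricBilinear (hyperbolic-isSymmetricBilinear {a} (suc n))

    w : Vec 𝔽₃ (suc n * 2 + a)
    w = c ∷ d ∷ w′

    -- c is its own inverse, so clear j kills the first coordinate of the members of the fibre over j.
    clear : 𝔽₃ → Vec 𝔽₃ (suc n * 2 + a) → Vec 𝔽₃ (suc n * 2 + a)
    clear j u = u -ᵥ (j ⊗ c) • w

    head-clear : ∀ j {u} → head u ≡ j → head (clear j u) ≡ 𝟎
    head-clear j {x ∷ u} refl = y⊖y⊗x⊗x≡𝟎 c x c≢𝟎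

    clear-isotropic : ∀ j {u v} → u ∈ fibre head j S → v ∈ fibre head j S →
                      hyperbolic n (dropPlane (clear j u)) (dropPlane (clear j v)) ≡ 𝟎
    clear-isotropic j {u} {v} u∈ v∈ =
      let u∈S , xᵤ≡j = ∈-fibre⁻ head j u∈ ; v∈S , xᵥ≡j = ∈-fibre⁻ head j v∈ in
      trans (hyperbolic-dropPlane n (clear j u) (clear j v) (head-clear j {u} xᵤ≡j) (head-clear j {v} xᵥ≡j))
            (shifts-orthogonal (j ⊗ c) {u} {v} {w} (S-iso u∈S v∈S) (S-iso u∈S w∈S) (S-iso w∈S v∈S) (S-iso w∈S w∈S))

    clear-injective : ∀ j {u v} → u ∈ fibre head j S → v ∈ fibre head j S →
                      dropPlane (clear j u) ≡ dropPlane (clear j v) → u ≡ v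
    clear-injective j {x ∷ y ∷ u} {x′ ∷ y′ ∷ v} u∈ v∈ eq
      with ∈-fibre⁻ head j u∈ | ∈-fibre⁻ head j v∈ | -ᵥ-cancelʳ u v _ eq
    ... | u∈S , refl | v∈S , refl | refl = cong (λ z → x ∷ z ∷ u)
      (⊗-cancelʳ c y y′ c≢𝟎 (⊕-cancelʳ (hyperbolic n u w′) _ _ (⊕-cancelˡ (x ⊗ d) _ _ (trans (S-iso u∈S w∈S) (sym (S-iso v∈S w∈S))))))

module _ {a : ℕ} (anisotropic : Anisotropic a) where

  totallyIsotropic-length≤ : ∀ n (S : List (Vec 𝔽₃ (n * 2 + a))) → Unique S → TotallyIsotropic (hyperbolic n) S →
                             length S ≤ 3 ^ n
  totallyIsotropic-length≤ zero S S! S-iso = unique-length≤1 (replicate a 𝟎) S S! (λ u∈ → anisotropic _ (S-iso u∈ u∈))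
  totallyIsotropic-length≤ (suc n) S S! S-iso = byHeads (All.all? (λ u → head u ≟ 𝟎) S)
    where
    open SplitPlane (totallyIsotropic-length≤ n) S! S-iso

    byHeads : Dec (All (λ u → head u ≡ 𝟎) S) → length S ≤ 3 ^ suc n
    byHeads (yes head≡𝟎) = length≤-headsVanish (All.lookup head≡𝟎)
    byHeads (no ¬head≡𝟎) =
      let _ , w∈S , head≢𝟎 = find (¬All⇒Any¬ (λ u → head u ≟ 𝟎) S ¬head≡𝟎) in length≤-headNonzero w∈S head≢𝟎

⟦adjCount⟧ : (u v : Vec 𝔽₃ k) → ⟦ adjCount K₃ u v ⟧ ≡ (u -ᵥ v) · (u -ᵥ v)
⟦adjCount⟧ [] [] = refl
⟦adjCount⟧ (x ∷ u) (y ∷ v) with adj? K₃ x y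
... | yes x≢y = cong₂ _⊕_ (sym (distinct-difference-square x y x≢y)) (⟦adjCount⟧ u v)
... | no ¬x≢y with refl ← decidable-stable (x ≟ y) ¬x≢y rewrite ⊖-self x = ⟦adjCount⟧ u v

nonadjacent⇔isotropic : (u v : Vec 𝔽₃ k) → (¬ Adj (powGraph K₃ k 3) u v) ⇔ ((u -ᵥ v) · (u -ᵥ v) ≡ 𝟎)
nonadjacent⇔isotropic u v = mk⇔
  (λ ¬adj → trans (sym (⟦adjCount⟧ u v)) (%3≡0⇒⟦⟧≡𝟎 (adjCount K₃ u v) (decidable-stable (adjCount K₃ u v % 3 ≟ℕ 0) ¬adj)))
  (λ isotropic adj → adj (⟦⟧≡𝟎⇒%3≡0 (adjCount K₃ u v) (trans (⟦adjCount⟧ u v) isotropic)))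

IsotropicDifferences : List (Vec 𝔽₃ k) → Set
IsotropicDifferences S = ∀ {u v} → u ∈ S → v ∈ S → (u -ᵥ v) · (u -ᵥ v) ≡ 𝟎

independent⇔ : {S : List (Vec 𝔽₃ k)} → IsIndependent (powGraph K₃ k 3) S ⇔ (Unique S × IsotropicDifferences S)
independent⇔ {k} {S} = mk⇔
  (λ (S! , S-nonadj) → S! , λ u∈ v∈ → isotropic (allPairs-lookup S-nonadj u∈ v∈))
  (λ (S! , S-diff) → S! , allPairs-tabulate S λ {u} {v} u∈ v∈ →
    Equivalence.from (nonadjacent⇔isotropic u v) (S-diff u∈ v∈) ,
    Equivalence.from (nonadjacent⇔isotropic v u) (S-diff v∈ u∈))
  where
  G : Graph
  G = powGraph K₃ k 3

  isotropic : ∀ {u v} → u ≡ v ⊎ (¬ Adj G u v × ¬ Adj G v u) ⊎ (¬ Adj G v u × ¬ Adj G u v) →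
              (u -ᵥ v) · (u -ᵥ v) ≡ 𝟎
  isotropic {u} (inj₁ refl) = ·-self-difference u
  isotropic {u} {v} (inj₂ (inj₁ (¬adj , _))) = Equivalence.to (nonadjacent⇔isotropic u v) ¬adj
  isotropic {u} {v} (inj₂ (inj₂ (_ , ¬adj))) = Equivalence.to (nonadjacent⇔isotropic u v) ¬adj

-- Over 𝔽₃ the sum of four squares is the orthogonal sum of two hyperbolic planes;
-- these are the coordinates with respect to a hyperbolic basis.
toHyperbolic₄ : 𝔽₃ → 𝔽₃ → 𝔽₃ → 𝔽₃ → Vec 𝔽₃ 4
toHyperbolic₄ x₁ x₂ x₃ x₄ = x₂ ⊕ x₃ ⊕ x₄ ∷ x₂ ⊕ x₃ ⊕ 𝟐 ⊗ x₄ ∷ x₁ ⊕ x₂ ⊕ 𝟐 ⊗ x₃ ∷ 𝟐 ⊗ x₁ ⊕ x₂ ⊕ 𝟐 ⊗ x₃ ∷ []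

fromHyperbolic₄ : Vec 𝔽₃ 4 → Vec 𝔽₃ 4
fromHyperbolic₄ (p₁ ∷ q₁ ∷ p₂ ∷ q₂ ∷ []) =
  q₂ ⊕ 𝟐 ⊗ p₂ ∷ q₁ ⊕ p₁ ⊕ q₂ ⊕ p₂ ∷ q₁ ⊕ p₁ ⊕ 𝟐 ⊗ q₂ ⊕ 𝟐 ⊗ p₂ ∷ q₁ ⊕ 𝟐 ⊗ p₁ ∷ []

fromHyperbolic₄-toHyperbolic₄ : ∀ x₁ x₂ x₃ x₄ → fromHyperbolic₄ (toHyperbolic₄ x₁ x₂ x₃ x₄) ≡ x₁ ∷ x₂ ∷ x₃ ∷ x₄ ∷ []
fromHyperbolic₄-toHyperbolic₄ = from-yes (all? λ x₁ → all? λ x₂ → all? λ x₃ → all? λ x₄ →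
  ≡-dec _≟_ (fromHyperbolic₄ (toHyperbolic₄ x₁ x₂ x₃ x₄)) (x₁ ∷ x₂ ∷ x₃ ∷ x₄ ∷ []))

hyperbolic-toHyperbolic₄ : ∀ x₁ x₂ x₃ x₄ y₁ y₂ y₃ y₄ →
  hyperbolic 2 (toHyperbolic₄ x₁ x₂ x₃ x₄) (toHyperbolic₄ y₁ y₂ y₃ y₄) ≡ (x₁ ∷ x₂ ∷ x₃ ∷ x₄ ∷ []) · (y₁ ∷ y₂ ∷ y₃ ∷ y₄ ∷ [])
hyperbolic-toHyperbolic₄ = from-yes (all? λ x₁ → all? λ x₂ → all? λ x₃ → all? λ x₄ →
  all? λ y₁ → all? λ y₂ → all? λ y₃ → all? λ y₄ →
  hyperbolic 2 (toHyperbolic₄ x₁ x₂ x₃ x₄) (toHyperbolic₄ y₁ y₂ y₃ y₄) ≟ (x₁ ∷ x₂ ∷ x₃ ∷ x₄ ∷ []) · (y₁ ∷ y₂ ∷ y₃ ∷ y₄ ∷ []))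

toHyperbolic : ∀ m → Vec 𝔽₃ (m * 4 + a) → Vec 𝔽₃ (m * 2 * 2 + a)
toHyperbolic zero u = u
toHyperbolic (suc m) (x₁ ∷ x₂ ∷ x₃ ∷ x₄ ∷ u) = toHyperbolic₄ x₁ x₂ x₃ x₄ ++ toHyperbolic m u

hyperbolic-toHyperbolic : ∀ m (u v : Vec 𝔽₃ (m * 4 + a)) →
                          hyperbolic (m * 2) (toHyperbolic m u) (toHyperbolic m v) ≡ u · v
hyperbolic-toHyperbolic zero u v = refl
hyperbolic-toHyperbolic (suc m) (x₁ ∷ x₂ ∷ x₃ ∷ x₄ ∷ u) (y₁ ∷ y₂ ∷ y₃ ∷ y₄ ∷ v) = begin
  hyperbolic (suc m * 2) (p ++ toHyperbolic m u) (q ++ toHyperbolic m v)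
    ≡⟨ ·-++ p (swapPlanes 2 q) (toHyperbolic m u) (swapPlanes (m * 2) (toHyperbolic m v)) ⟩
  hyperbolic 2 p q ⊕ hyperbolic (m * 2) (toHyperbolic m u) (toHyperbolic m v)
    ≡⟨ cong₂ _⊕_ (hyperbolic-toHyperbolic₄ x₁ x₂ x₃ x₄ y₁ y₂ y₃ y₄) (hyperbolic-toHyperbolic m u v) ⟩
  x · y ⊕ u · v
    ≡⟨ ·-++ x y u v ⟨
  (x ++ u) · (y ++ v)
    ∎
  where
  p q x y : Vec 𝔽₃ 4
  p = toHyperbolic₄ x₁ x₂ x₃ x₄
  q = toHyperbolic₄ y₁ y₂ y₃ y₄
  x = x₁ ∷ x₂ ∷ x₃ ∷ x₄ ∷ []
  y = y₁ ∷ y₂ ∷ y₃ ∷ y₄ ∷ []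

toHyperbolic-injective : ∀ m (u v : Vec 𝔽₃ (m * 4 + a)) → toHyperbolic m u ≡ toHyperbolic m v → u ≡ v
toHyperbolic-injective zero u v eq = eq
toHyperbolic-injective (suc m) (x₁ ∷ x₂ ∷ x₃ ∷ x₄ ∷ u) (y₁ ∷ y₂ ∷ y₃ ∷ y₄ ∷ v) eq
  with p≡q , u′≡v′ ← ++-injective (toHyperbolic₄ x₁ x₂ x₃ x₄) (toHyperbolic₄ y₁ y₂ y₃ y₄) eq =
  cong₂ _++_ x≡y (toHyperbolic-injective m u v u′≡v′)
  where
  x≡y : x₁ ∷ x₂ ∷ x₃ ∷ x₄ ∷ [] ≡ y₁ ∷ y₂ ∷ y₃ ∷ y₄ ∷ []
  x≡y = begin
    x₁ ∷ x₂ ∷ x₃ ∷ x₄ ∷ []                      ≡⟨ fromHyperbolic₄-toHyperbolic₄ x₁ x₂ x₃ x₄ ⟨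
    fromHyperbolic₄ (toHyperbolic₄ x₁ x₂ x₃ x₄) ≡⟨ cong fromHyperbolic₄ p≡q ⟩
    fromHyperbolic₄ (toHyperbolic₄ y₁ y₂ y₃ y₄) ≡⟨ fromHyperbolic₄-toHyperbolic₄ y₁ y₂ y₃ y₄ ⟩
    y₁ ∷ y₂ ∷ y₃ ∷ y₄ ∷ []                      ∎

independent-length≤ : Anisotropic a → ∀ m (S : List (Vec 𝔽₃ (m * 4 + a))) →
                      IsIndependent (powGraph K₃ (m * 4 + a) 3) S → length S ≤ 3 ^ (m * 2)
independent-length≤ anisotropic m [] _ = z≤n
independent-length≤ {a} anisotropic m S@(s ∷ _) S-independent = subst (_≤ 3 ^ (m * 2)) (length-map f S)
  (totallyIsotropic-length≤ anisotropic (m * 2) (map f S) (Unique.map⁺ f-injective S!) (totallyIsotropic-map f f-isotropic))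
  where
  open IsSymmetricBilinear ·-isSymmetricBilinear
  S! : Unique S
  S! = proj₁ (Equivalence.to independent⇔ S-independent)

  S-diff : IsotropicDifferences S
  S-diff = proj₂ (Equivalence.to independent⇔ S-independent)

  f : Vec 𝔽₃ (m * 4 + a) → Vec 𝔽₃ (m * 2 * 2 + a)
  f u = toHyperbolic m (u -ᵥ s)

  f-injective : ∀ {u v} → f u ≡ f v → u ≡ v
  f-injective {u} {v} eq = -ᵥ-cancelʳ u v s (toHyperbolic-injective m _ _ eq)

  f-isotropic : ∀ {u v} → u ∈ S → v ∈ S → hyperbolic (m * 2) (f u) (f v) ≡ 𝟎
  f-isotropic {u} {v} u∈ v∈ = trans (hyperbolic-toHyperbolic m (u -ᵥ s) (v -ᵥ s))
    (isotropic-difference⇒orthogonal {u -ᵥ s} {v -ᵥ s} (S-diff u∈ (here refl)) (S-diff v∈ (here refl))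
      (subst (λ d → d · d ≡ 𝟎) (sym (-ᵥ--ᵥ-cancelʳ u v s)) (S-diff u∈ v∈)))

length-cartesianProductWith : ∀ {A B C : Set} (f : A → B → C) xs ys →
                              length (cartesianProductWith f xs ys) ≡ length xs * length ys
length-cartesianProductWith f [] ys = refl
length-cartesianProductWith f (x ∷ xs) ys =
  trans (length-++ (map (f x) ys)) (cong₂ _+_ (length-map (f x) ys) (length-cartesianProductWith f xs ys))

tetracode : List (Vec 𝔽₃ 4)
tetracode =
  (𝟎 ∷ 𝟎 ∷ 𝟎 ∷ 𝟎 ∷ []) ∷ (𝟎 ∷ 𝟏 ∷ 𝟏 ∷ 𝟐 ∷ []) ∷ (𝟎 ∷ 𝟐 ∷ 𝟐 ∷ 𝟏 ∷ []) ∷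
  (𝟏 ∷ 𝟎 ∷ 𝟏 ∷ 𝟏 ∷ []) ∷ (𝟏 ∷ 𝟏 ∷ 𝟐 ∷ 𝟎 ∷ []) ∷ (𝟏 ∷ 𝟐 ∷ 𝟎 ∷ 𝟐 ∷ []) ∷
  (𝟐 ∷ 𝟎 ∷ 𝟐 ∷ 𝟐 ∷ []) ∷ (𝟐 ∷ 𝟏 ∷ 𝟎 ∷ 𝟏 ∷ []) ∷ (𝟐 ∷ 𝟐 ∷ 𝟏 ∷ 𝟎 ∷ []) ∷ []

tetracode-unique : Unique tetracode
tetracode-unique = from-yes (allPairs? (λ u v → ¬? (≡-dec _≟_ u v)) tetracode)

tetracode-isotropicDifferences : IsotropicDifferences tetracode
tetracode-isotropicDifferences u∈ v∈ = All.lookup (All.lookup isotropic u∈) v∈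
  where
  isotropic : All (λ u → All (λ v → (u -ᵥ v) · (u -ᵥ v) ≡ 𝟎) tetracode) tetracode
  isotropic = from-yes (All.all? (λ u → All.all? (λ v → (u -ᵥ v) · (u -ᵥ v) ≟ 𝟎) tetracode) tetracode)

tetracodePower : ∀ m → List (Vec 𝔽₃ (m * 4 + a))
tetracodePower {a} zero = replicate a 𝟎 ∷ []
tetracodePower (suc m) = cartesianProductWith _++_ tetracode (tetracodePower m)

length-tetracodePower : ∀ m → length (tetracodePower {a} m) ≡ 3 ^ (m * 2)
length-tetracodePower zero = refl
length-tetracodePower (suc m) = begin
  length (cartesianProductWith _++_ tetracode (tetracodePower m)) ≡⟨ length-cartesianProductWith _++_ tetracode (tetracodePower m) ⟩
  9 * length (tetracodePower m)                                   ≡⟨ cong (9 *_) (length-tetracodePower m) ⟩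
  9 * 3 ^ (m * 2)                                                 ≡⟨ *-assoc 3 3 (3 ^ (m * 2)) ⟩
  3 ^ (suc m * 2)                                                 ∎

tetracodePower-unique : ∀ m → Unique (tetracodePower {a} m)
tetracodePower-unique zero = [] ∷ []
tetracodePower-unique (suc m) =
  Unique.cartesianProductWith⁺ _++_ (λ {w} {x} → ++-injective w x) tetracode-unique (tetracodePower-unique m)

tetracodePower-isotropicDifferences : ∀ m → IsotropicDifferences (tetracodePower {a} m)
tetracodePower-isotropicDifferences {a} zero (here refl) (here refl) = ·-self-difference (replicate a 𝟎)
tetracodePower-isotropicDifferences (suc m) u∈ v∈
  with x , u , x∈ , u∈′ , refl ← ∈-cartesianProductWith⁻ _++_ tetracode (tetracodePower m) u∈
     | y , v , y∈ , v∈′ , refl ← ∈-cartesianProductWith⁻ _++_ tetracode (tetracodePower m) v∈ = begin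
  ((x ++ u) -ᵥ (y ++ v)) · ((x ++ u) -ᵥ (y ++ v))          ≡⟨ cong (λ d → d · d) (-ᵥ-++ x y u v) ⟩
  ((x -ᵥ y) ++ (u -ᵥ v)) · ((x -ᵥ y) ++ (u -ᵥ v))          ≡⟨ ·-++ (x -ᵥ y) (x -ᵥ y) (u -ᵥ v) (u -ᵥ v) ⟩
  (x -ᵥ y) · (x -ᵥ y) ⊕ (u -ᵥ v) · (u -ᵥ v)                ≡⟨ cong₂ _⊕_ (tetracode-isotropicDifferences x∈ y∈)
                                                                        (tetracodePower-isotropicDifferences m u∈′ v∈′) ⟩
  𝟎                                                          ∎

independenceNumber : Anisotropic a → ∀ m → IsIndependenceNumber (powGraph K₃ (m * 4 + a) 3) (3 ^ (m * 2))
independenceNumber anisotropic m =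
  ( tetracodePower m
  , Equivalence.from independent⇔ (tetracodePower-unique m , tetracodePower-isotropicDifferences m)
  , length-tetracodePower m )
  , independent-length≤ anisotropic m

anisotropic₀ : Anisotropic 0
anisotropic₀ [] _ = refl

anisotropic₂ : Anisotropic 2
anisotropic₂ (x ∷ y ∷ []) = from-yes (all? λ x → all? λ y →
  ((x ∷ y ∷ []) · (x ∷ y ∷ []) ≟ 𝟎) →-dec ≡-dec _≟_ (x ∷ y ∷ []) (𝟎 ∷ 𝟎 ∷ [])) x y

independenceNumber-≡ : Anisotropic a → ∀ {k} m → k ≡ m * 4 + a → IsIndependenceNumber (powGraph K₃ k 3) (3 ^ (m * 2))
independenceNumber-≡ anisotropic m refl = independenceNumber anisotropic m

k≡[k/4]*4+k%4 : ∀ k {r} → k % 4 ≡ r → k ≡ k / 4 * 4 + r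
k≡[k/4]*4+k%4 k {r} k%4≡r = trans (m≡m%n+[m/n]*n k 4) (trans (cong (_+ k / 4 * 4) k%4≡r) (+-comm r (k / 4 * 4)))

[m*4+e*2]/2≡m*2+e : ∀ m e → (m * 4 + e * 2) / 2 ≡ m * 2 + e
[m*4+e*2]/2≡m*2+e m e = trans (cong (_/ 2) m*4+e*2≡[m*2+e]*2) (m*n/n≡m (m * 2 + e) 2)
  where
  m*4+e*2≡[m*2+e]*2 : m * 4 + e * 2 ≡ (m * 2 + e) * 2
  m*4+e*2≡[m*2+e]*2 = sym (trans (*-distribʳ-+ 2 (m * 2) e) (cong (_+ e * 2) (*-assoc m 2 2)))

theorem3p5 : (k : ℕ) → k ≥ 1 → k % 2 ≡ 0 →
    (k % 4 ≡ 0 → IsIndependenceNumber (powGraph K₃ k 3) (3 ^ (k / 2)))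
    × (k % 4 ≡ 2 → Σ ℕ (λ a → IsIndependenceNumber (powGraph K₃ k 3) a
                        × 3 ^ (k / 2) ≤ 3 * a × 2 * a < 3 ^ (k / 2)))
theorem3p5 k _ _ = k≡4q⇒ , k≡4q+2⇒
  where
  q : ℕ
  q = k / 4

  k≡4q⇒ : k % 4 ≡ 0 → IsIndependenceNumber (powGraph K₃ k 3) (3 ^ (k / 2))
  k≡4q⇒ k%4≡0 = subst (IsIndependenceNumber (powGraph K₃ k 3)) (cong (3 ^_) (sym k/2≡q*2))
                      (independenceNumber-≡ anisotropic₀ q k≡q*4)
    where
    k≡q*4 : k ≡ q * 4 + 0
    k≡q*4 = k≡[k/4]*4+k%4 k k%4≡0
    k/2≡q*2 : k / 2 ≡ q * 2
    k/2≡q*2 = trans (cong (_/ 2) k≡q*4) (trans ([m*4+e*2]/2≡m*2+e q 0) (+-identityʳ (q * 2)))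

  k≡4q+2⇒ : k % 4 ≡ 2 → Σ ℕ (λ α → IsIndependenceNumber (powGraph K₃ k 3) α × 3 ^ (k / 2) ≤ 3 * α × 2 * α < 3 ^ (k / 2))
  k≡4q+2⇒ k%4≡2 = α , independenceNumber-≡ anisotropic₂ q k≡q*4+2 , ≤-reflexive 3^[k/2]≡3α
                , subst (2 * α <_) (sym 3^[k/2]≡3α) (+-monoˡ-< (2 * α) (m^n>0 3 (q * 2)))
    where
    α : ℕ
    α = 3 ^ (q * 2)
    k≡q*4+2 : k ≡ q * 4 + 2
    k≡q*4+2 = k≡[k/4]*4+k%4 k k%4≡2
    3^[k/2]≡3α : 3 ^ (k / 2) ≡ 3 * α
    3^[k/2]≡3α = cong (3 ^_) (trans (cong (_/ 2) k≡q*4+2) (trans ([m*4+e*2]/2≡m*2+e q 1) (+-comm (q * 2) 1)))
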